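{- For every $n \ge 1$ and every array $A[1..n]$ of $n$ real numbers, the call $\mathrm{ExpoSort}(A, n)$ terminates with $A$ sorted in nondecreasing order (i.e.\ $A$ is rearranged into a nondecreasing permutation of its original entries). Moreover, its running time $T(n)$ on arrays of length $n$ satisfies $T(n) = \Theta(2^n)$.
   Context: Arrays are indexed from $1$. The procedure $\mathrm{ExpoSort}(A, m)$, acting in place on the prefix $A[1..m]$, is defined recursively as follows: if $m > 1$, then (1) call $\mathrm{ExpoSort}(A, m-1)$; (2) if $A[m-1] > A[m]$, swap $A[m-1]$ and $A[m]$; (3) call $\mathrm{ExpoSort}(A, m-1)$. If $m \le 1$ it does nothing. Running time is measured in the unit-cost model where each comparison, swap, test and procedure call costs $O(1)$. -}

module Defs where

open import Level using (Level)
open import Data.Nat using (ℕ; zero; suc; _+_)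
open import Data.Product using (_×_; _,_; proj₁; proj₂)
open import Data.Vec using (Vec; []; _∷_; _∷ʳ_; init; last)
open import Relation.Nullary using (yes; no)
open import Relation.Binary.Bundles using (DecTotalOrder)

-- ExpoSort over an arbitrary decidable total order (the algorithm only
-- compares entries).  An array A[1..m] is a Vec of length m; the call
-- ExpoSort(A, m) acts on the whole vector.  The result pairs the final
-- array with the number of unit-cost operations performed:
--   * 1 for the procedure call itself (including the test m > 1),
--   * 1 for the comparison A[m-1] > A[m],
--   * 1 for the swap, when it is performed.
module ExpoSort {a ℓ₁ ℓ₂ : Level} (O : DecTotalOrder a ℓ₁ ℓ₂) where
  open DecTotalOrder O using (Carrier; _≤?_)

  compareSwap : Carrier → Carrier → (Carrier × Carrier) × ℕ
  compareSwap x y with x ≤? y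
  ... | yes _ = (x , y) , 1
  ... | no  _ = (y , x) , 2

  run : (m : ℕ) → Vec Carrier m → Vec Carrier m × ℕ
  run zero v = v , 1
  run (suc zero) v = v , 1
  run (suc (suc k)) v =
    let r₁ = run (suc k) (init v)
        w  = proj₁ r₁
        s  = compareSwap (last w) (last v)
        p  = proj₁ s
        r₂ = run (suc k) (init w ∷ʳ proj₁ p)
    in (proj₁ r₂ ∷ʳ proj₂ p) , (1 + proj₂ r₁ + proj₂ s + proj₂ r₂)

  expoSort : (n : ℕ) → Vec Carrier n → Vec Carrier n
  expoSort n v = proj₁ (run n v)

  cost : (n : ℕ) → Vec Carrier n → ℕ
  cost n v = proj₂ (run n v)

module Submission where

open import Defs
open import Level using (Level)
open import Data.Nat using (ℕ; _≤_; _*_; _^_; zero; suc; _+_; s≤s; z≤n)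
open import Data.Nat.Properties
  using (≤-trans; +-mono-≤; *-monoʳ-≤; +-monoˡ-≤; +-monoʳ-≤; m≤m+n; m≤n+m; +-identityʳ; module ≤-Reasoning)
open import Data.Nat.Solver using (module +-*-Solver)
open import Data.Product using (_×_; ∃-syntax; _,_; proj₁; proj₂)
open import Data.List using (List; []; _∷_; _++_; [_]; _∷ʳ_)
open import Data.List.Properties using (++-assoc)
open import Data.List.Relation.Unary.All as All using (All; []; _∷_)
import Data.List.Relation.Unary.All.Properties as All
open import Data.List.Relation.Unary.Linked using ([]; [-]; _∷_)
open import Data.List.Relation.Unary.Sorted.TotalOrder using (Sorted)
open import Data.List.Relation.Binary.Permutation.Propositional
  using (_↭_; ↭-refl; ↭-sym; ↭-swap; module PermutationReasoning)
open import Data.List.Relation.Binary.Permutation.Propositional.Properties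
  using (++⁺ˡ; ++⁺ʳ; All-resp-↭)
open import Data.Vec using (Vec; toList; init; last; initLast)
  renaming ([] to []ᵛ; _∷_ to _∷ᵛ_; _∷ʳ_ to _∷ʳᵛ_)
open import Data.Vec.Properties using (toList-∷ʳ)
open import Relation.Binary.Bundles using (TotalOrder; DecTotalOrder)
import Relation.Binary.Properties.TotalOrder as TotalOrderProperties
open import Relation.Binary.PropositionalEquality using (_≡_; refl; sym; trans; cong; subst)
open import Relation.Nullary using (yes; no)

-- Correctness is the usual invariant of this recursion: after the first
-- recursive call the last entry of the prefix is its maximum, the
-- compare-and-swap moves the maximum of the whole array to position m, and the
-- second recursive call sorts the prefix without touching position m.  The
-- cost satisfies T(1) = 1 and 2 T(m-1) + 2 ≤ T(m) ≤ 2 T(m-1) + 3, whence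
-- 2^(m-1) ≤ T(m) ≤ 2^(m+1) - 3.

module _ {a ℓ₁ ℓ₂ : Level} (O : TotalOrder a ℓ₁ ℓ₂) where
  open TotalOrder O using (Carrier) renaming (_≤_ to _≼_; trans to ≼-trans)

  sorted-∷ʳ⁺ : ∀ {x} {xs : List Carrier} →
    Sorted O xs → All (_≼ x) xs → Sorted O (xs ∷ʳ x)
  sorted-∷ʳ⁺ []             []          = [-]
  sorted-∷ʳ⁺ [-]            (y≼x ∷ [])  = y≼x ∷ [-]
  sorted-∷ʳ⁺ (y≼z ∷ sorted) (_ ∷ zs≼x)  = y≼z ∷ sorted-∷ʳ⁺ sorted zs≼x

  sorted-∷ʳ⁻ : ∀ {x} (xs : List Carrier) → Sorted O (xs ∷ʳ x) → All (_≼ x) xs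
  sorted-∷ʳ⁻ []           _              = []
  sorted-∷ʳ⁻ (y ∷ [])     (y≼x ∷ _)      = y≼x ∷ []
  sorted-∷ʳ⁻ (y ∷ z ∷ zs) (y≼z ∷ sorted) with sorted-∷ʳ⁻ (z ∷ zs) sorted
  ... | z≼x ∷ zs≼x = ≼-trans y≼z z≼x ∷ z≼x ∷ zs≼x

toList-init-last : ∀ {a} {A : Set a} {n} (v : Vec A (suc n)) →
  toList v ≡ toList (init v) ∷ʳ last v
toList-init-last v =
  trans (cong toList (proj₂ (proj₂ (initLast v)))) (toList-∷ʳ (last v) (init v))

lower-bound-doubles : ∀ {b t₁ t₂} s → b ≤ t₁ → b ≤ t₂ → 2 * b ≤ 1 + t₁ + s + t₂
lower-bound-doubles {b} {t₁} {t₂} s b≤t₁ b≤t₂ = begin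
  2 * b           ≡⟨ cong (b +_) (+-identityʳ b) ⟩
  b + b           ≤⟨ +-mono-≤ b≤t₁ b≤t₂ ⟩
  t₁ + t₂         ≤⟨ +-monoˡ-≤ t₂ (≤-trans (m≤n+m t₁ 1) (m≤m+n (1 + t₁) s)) ⟩
  1 + t₁ + s + t₂ ∎
  where open ≤-Reasoning

upper-bound-doubles : ∀ {b t₁ t₂ s} →
  t₁ + 3 ≤ b → t₂ + 3 ≤ b → s ≤ 2 → 1 + t₁ + s + t₂ + 3 ≤ 2 * b
upper-bound-doubles {b} {t₁} {t₂} {s} t₁+3≤b t₂+3≤b s≤2 = begin
  1 + t₁ + s + t₂ + 3       ≤⟨ +-monoˡ-≤ 3 (+-monoˡ-≤ t₂ (+-monoʳ-≤ (1 + t₁) s≤2)) ⟩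
  1 + t₁ + 2 + t₂ + 3       ≡⟨ solve 2 (λ x y → con 1 :+ x :+ con 2 :+ y :+ con 3
                                            := (x :+ con 3) :+ (y :+ con 3)) refl t₁ t₂ ⟩
  (t₁ + 3) + (t₂ + 3)       ≤⟨ +-mono-≤ t₁+3≤b t₂+3≤b ⟩
  b + b                     ≡⟨ cong (b +_) (+-identityʳ b) ⟨
  2 * b                     ∎
  where open ≤-Reasoning
        open +-*-Solver

module ExpoSortProperties {a ℓ₁ ℓ₂ : Level} (O : DecTotalOrder a ℓ₁ ℓ₂) where
  open DecTotalOrder O using (Carrier; _≤?_; totalOrder)
    renaming (_≤_ to _≼_; refl to ≼-refl; trans to ≼-trans)
  open TotalOrderProperties totalOrder using (≰⇒≥)
  open ExpoSort O

  module _ (x y : Carrier) where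
    private
      lo hi : Carrier
      lo = proj₁ (proj₁ (compareSwap x y))
      hi = proj₂ (proj₁ (compareSwap x y))

    compareSwap-ordered : lo ≼ hi
    compareSwap-ordered with x ≤? y
    ... | yes x≼y = x≼y
    ... | no  x⋠y = ≰⇒≥ x⋠y

    compareSwap-max : x ≼ hi
    compareSwap-max with x ≤? y
    ... | yes x≼y = x≼y
    ... | no  _   = ≼-refl

    compareSwap-↭ : lo ∷ hi ∷ [] ↭ x ∷ y ∷ []
    compareSwap-↭ with x ≤? y
    ... | yes _ = ↭-refl
    ... | no  _ = ↭-swap y x ↭-refl

    compareSwap-cost≤2 : proj₂ (compareSwap x y) ≤ 2
    compareSwap-cost≤2 with x ≤? y
    ... | yes _ = s≤s z≤n
    ... | no  _ = s≤s (s≤s z≤n)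

  module Step {k} (v : Vec Carrier (suc (suc k))) where
    w : Vec Carrier (suc k)
    w = expoSort (suc k) (init v)

    lo hi : Carrier
    lo = proj₁ (proj₁ (compareSwap (last w) (last v)))
    hi = proj₂ (proj₁ (compareSwap (last w) (last v)))

    r : Vec Carrier (suc k)
    r = expoSort (suc k) (init w ∷ʳᵛ lo)

  expoSort-↭ : ∀ m (v : Vec Carrier m) → toList (expoSort m v) ↭ toList v
  expoSort-↭ zero          []ᵛ             = ↭-refl
  expoSort-↭ (suc zero)    (_ ∷ᵛ []ᵛ)      = ↭-refl
  expoSort-↭ (suc (suc k)) v = begin
    toList (r ∷ʳᵛ hi)                       ≡⟨ toList-∷ʳ hi r ⟩
    toList r ∷ʳ hi                          ↭⟨ ++⁺ʳ [ hi ] (expoSort-↭ (suc k) (init w ∷ʳᵛ lo)) ⟩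
    toList (init w ∷ʳᵛ lo) ∷ʳ hi            ≡⟨ cong (_∷ʳ hi) (toList-∷ʳ lo (init w)) ⟩
    (toList (init w) ∷ʳ lo) ∷ʳ hi           ≡⟨ ++-assoc (toList (init w)) [ lo ] [ hi ] ⟩
    toList (init w) ++ lo ∷ hi ∷ []         ↭⟨ ++⁺ˡ (toList (init w)) (compareSwap-↭ (last w) (last v)) ⟩
    toList (init w) ++ last w ∷ last v ∷ [] ≡⟨ ++-assoc (toList (init w)) [ last w ] [ last v ] ⟨
    (toList (init w) ∷ʳ last w) ∷ʳ last v   ≡⟨ cong (_∷ʳ last v) (toList-init-last w) ⟨
    toList w ∷ʳ last v                      ↭⟨ ++⁺ʳ [ last v ] (expoSort-↭ (suc k) (init v)) ⟩
    toList (init v) ∷ʳ last v               ≡⟨ toList-init-last v ⟨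
    toList v                                ∎
    where
    open PermutationReasoning
    open Step v

  expoSort-sorted : ∀ m (v : Vec Carrier m) → Sorted totalOrder (toList (expoSort m v))
  expoSort-sorted zero          []ᵛ        = []
  expoSort-sorted (suc zero)    (_ ∷ᵛ []ᵛ) = [-]
  expoSort-sorted (suc (suc k)) v =
    subst (Sorted totalOrder) (sym (toList-∷ʳ hi r))
      (sorted-∷ʳ⁺ totalOrder (expoSort-sorted (suc k) (init w ∷ʳᵛ lo))
        (r≼hi (expoSort-sorted (suc k) (init v))))
    where
    open Step v

    init-w≼hi : Sorted totalOrder (toList w) → All (_≼ hi) (toList (init w))
    init-w≼hi sorted-w =
      All.map (λ z≼last-w → ≼-trans z≼last-w (compareSwap-max (last w) (last v)))
        (sorted-∷ʳ⁻ totalOrder (toList (init w))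
          (subst (Sorted totalOrder) (toList-init-last w) sorted-w))

    r≼hi : Sorted totalOrder (toList w) → All (_≼ hi) (toList r)
    r≼hi sorted-w = All-resp-↭ (↭-sym (expoSort-↭ (suc k) (init w ∷ʳᵛ lo)))
      (subst (All (_≼ hi)) (sym (toList-∷ʳ lo (init w)))
        (All.++⁺ (init-w≼hi sorted-w) (compareSwap-ordered (last w) (last v) ∷ [])))

  cost-lower : ∀ k (v : Vec Carrier (suc k)) → 2 ^ k ≤ cost (suc k) v
  cost-lower zero    v = s≤s z≤n
  cost-lower (suc k) v =
    lower-bound-doubles (proj₂ (compareSwap (last w) (last v)))
      (cost-lower k (init v)) (cost-lower k _)
    where open Step v

  cost-upper : ∀ k (v : Vec Carrier (suc k)) → cost (suc k) v + 3 ≤ 2 ^ (2 + k)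
  cost-upper zero    v = s≤s (s≤s (s≤s (s≤s z≤n)))
  cost-upper (suc k) v =
    upper-bound-doubles (cost-upper k (init v)) (cost-upper k _)
      (compareSwap-cost≤2 (last w) (last v))
    where open Step v

mainTheorem1 : ∀ {a ℓ₁ ℓ₂ : Level} (O : DecTotalOrder a ℓ₁ ℓ₂) →
    ((n : ℕ) → 1 ≤ n → (A : Vec (DecTotalOrder.Carrier O) n) →
    Sorted (DecTotalOrder.totalOrder O) (toList (ExpoSort.expoSort O n A))
    × (toList (ExpoSort.expoSort O n A) ↭ toList A))
    × (∃[ c₁ ] ∃[ c₂ ] ∃[ n₀ ] ((n : ℕ) → n₀ ≤ n → (A : Vec (DecTotalOrder.Carrier O) n) →
    (2 ^ n ≤ c₁ * ExpoSort.cost O n A) × (ExpoSort.cost O n A ≤ c₂ * 2 ^ n)))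
mainTheorem1 O =
  (λ n _ A → expoSort-sorted n A , expoSort-↭ n A) , 2 , 2 , 1 , bounds
  where
  open ExpoSortProperties O
  open ExpoSort O using (cost)

  bounds : (n : ℕ) → 1 ≤ n → (A : Vec (DecTotalOrder.Carrier O) n) →
    (2 ^ n ≤ 2 * cost n A) × (cost n A ≤ 2 * 2 ^ n)
  bounds (suc k) _ A =
    *-monoʳ-≤ 2 (cost-lower k A) ,
    ≤-trans (m≤m+n (cost (suc k) A) 3) (cost-upper k A)
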